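{- Let $G$ be a connected graph. Then $\operatorname{th_+^\times}(G)\geq 1+\operatorname{rad}(G)$, with equality whenever $G$ is a tree.
   Context: All graphs are finite and simple. PSD color change rule: given a set $B$ of blue vertices (others white), let $W_1,\dots,W_k$ be the vertex sets of the components of $G-B$; if $u\in B$ and $w\in W_i$ is the only white neighbor of $u$ in $G[W_i\cup B]$, then $u$ can force $w$ (turn it blue). For $S\subseteq V(G)$ set $S^{[0]}=S$ and, for $i\ge1$, $S^{[i]}=S^{[i-1]}\cup\{w\notin S^{[i-1]}: w \text{ can be forced by some vertex when the blue set is } S^{[i-1]}\}$. $S$ is a PSD forcing set if $S^{[i]}=V(G)$ for some $i$. The PSD propagation time $\operatorname{pt_+}(G;S)$ is the least $p$ with $S^{[p]}=V(G)$ ($\infty$ if no such $p$). $\operatorname{Z_+}(G)$ is the minimum size of a PSD forcing set. The initial cost PSD product throttling number is $\operatorname{th_+^\times}(G)=\min\{|S|(1+\operatorname{pt_+}(G;S)) : S\subseteq V(G),\ |S|\ge \operatorname{Z_+}(G)\}$. $\operatorname{rad}(G)$ is the radius of $G$. -}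

module Defs where

open import Data.Nat using (ℕ; zero; suc; _+_; _*_; _≤_; _<_)
open import Data.Fin using (Fin)
open import Data.Fin.Subset using (Subset; _∈_; ∣_∣)
open import Data.Bool using (Bool; true; false)
open import Data.List using (List; []; _∷_; length; _∷ʳ_)
open import Data.List.Relation.Unary.Unique.Propositional using (Unique)
open import Data.List.Relation.Unary.Linked using (Linked)
open import Data.Product using (Σ; ∃; ∃-syntax; _×_; _,_)
open import Data.Sum using (_⊎_)
open import Data.Empty using (⊥)
open import Relation.Nullary using (¬_)
open import Relation.Binary.PropositionalEquality using (_≡_)

record Graph (n : ℕ) : Set where
  field
    adj   : Fin n → Fin n → Bool
    sym   : ∀ u v → adj u v ≡ adj v u
    irrefl : ∀ v → adj v v ≡ false

module _ {n : ℕ} (G : Graph n) where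
  open Graph G

  Adj : Fin n → Fin n → Set
  Adj u v = adj u v ≡ true

  data Walk : Fin n → Fin n → ℕ → Set where
    here : ∀ {u} → Walk u u 0
    step : ∀ {u w v k} → Adj u w → Walk w v k → Walk u v (suc k)

  Connected : Set
  Connected = ∀ u v → ∃[ k ] Walk u v k

  IsDist : Fin n → Fin n → ℕ → Set
  IsDist u v d = Walk u v d × (∀ k → Walk u v k → d ≤ k)

  IsEcc : Fin n → ℕ → Set
  IsEcc v e = (∀ u d → IsDist v u d → d ≤ e) × (∃[ u ] IsDist v u e)

  IsRadius : ℕ → Set
  IsRadius r = (∃[ v ] IsEcc v r) × (∀ v e → IsEcc v e → r ≤ e)

  IsCycle : List (Fin n) → Set
  IsCycle [] = ⊥
  IsCycle (v ∷ vs) = (3 ≤ length (v ∷ vs)) × Unique (v ∷ vs) × Linked Adj ((v ∷ vs) ∷ʳ v)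

  IsTree : Set
  IsTree = Connected × (∀ c → ¬ IsCycle c)

  -- PSD color change rule, blue set given as a predicate B.
  -- ReachW B x y : x and y lie in the same component of G - B.
  data ReachW (B : Fin n → Set) : Fin n → Fin n → Set where
    rrefl : ∀ {x} → ¬ B x → ReachW B x x
    rstep : ∀ {x y z} → ReachW B x y → Adj y z → ¬ B z → ReachW B x z

  CanForce : (Fin n → Set) → Fin n → Fin n → Set
  CanForce B u w = B u × ¬ B w × Adj u w ×
                   (∀ x → Adj u x → ¬ B x → ReachW B w x → x ≡ w)

  Blue : Subset n → ℕ → Fin n → Set
  Blue S zero v = v ∈ S
  Blue S (suc i) v = Blue S i v ⊎ (∃[ u ] CanForce (Blue S i) u v)

  AllBlue : Subset n → ℕ → Set
  AllBlue S i = ∀ v → Blue S i v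

  IsPSDForcingSet : Subset n → Set
  IsPSDForcingSet S = ∃[ i ] AllBlue S i

  IsPSDPropTime : Subset n → ℕ → Set
  IsPSDPropTime S p = AllBlue S p × (∀ q → AllBlue S q → p ≤ q)

  IsZplus : ℕ → Set
  IsZplus z = (∃[ S ] (IsPSDForcingSet S × ∣ S ∣ ≡ z)) ×
              (∀ S → IsPSDForcingSet S → z ≤ ∣ S ∣)

  -- t = th_+^×(G): minimum of |S|(1+pt_+(G;S)) over S with |S| ≥ Z_+(G)
  -- (sets with infinite propagation time contribute ∞ and are never the minimum
  -- when a forcing set exists, so only finite pt is considered).
  IsPSDProdThrottling : ℕ → Set
  IsPSDProdThrottling t =
    (∃[ S ] ∃[ p ] ∃[ z ] (IsZplus z × z ≤ ∣ S ∣ × IsPSDPropTime S p × ∣ S ∣ * (1 + p) ≡ t)) ×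
    (∀ S p z → IsZplus z → z ≤ ∣ S ∣ → IsPSDPropTime S p → t ≤ ∣ S ∣ * (1 + p))

{-# OPTIONS --safe #-}
module Submission where

-- If S forces G in p rounds, every vertex is within distance p of S, so |S| balls of radius p cover G.
-- Two balls of radii q₀ and q joined by an edge lie in one ball of radius q₀ + q + 1; as G is connected,
-- merging repeatedly puts G inside one ball of radius |S|(1 + p) − 1, whence 1 + rad G ≤ |S|(1 + p).
-- In a tree, a blue vertex u with a white neighbour w has no other white neighbour in the component of w,
-- since a white path between the two would close a cycle through u. So a centre c alone turns every
-- vertex at distance i blue by round i, and {c} forces G in rad G rounds: th₊^×(G) ≤ 1 + rad G.
-- The minima in the definitions exist because every predicate involved is decidable and the blue set
-- stops growing after n rounds.

open import Defs
open import Data.Bool using (true; false)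
open import Data.Empty using (⊥-elim)
open import Data.Fin using (Fin; zero; suc; fromℕ<)
open import Data.Fin.Properties using (any?; all?; ¬∀⟶∃¬; injective⇒≤) renaming (_≟_ to _≟ᶠ_)
open import Data.Fin.Subset using (Subset; ∣_∣; ⊤; ⁅_⁆; inside; outside) renaming (_∈_ to _∈ₛ_)
open import Data.Fin.Subset.Properties
  using (_∈?_; ∈⊤; ∣⊤∣≡n; ∣p∣≤n; ∣p∣≡n⇒p≡⊤; p⊂q⇒∣p∣<∣q∣; anySubset?; x∈⁅x⁆; ∣⁅x⁆∣≡1)
open import Data.List using (List; []; _∷_; length; lookup; allFin; last; map)
open import Data.List.Extrema.Nat using (argmin; argmax; f[argmin]≤f[xs]; f[xs]≤f[argmax])
open import Data.List.Membership.Propositional using (_∈_)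
open import Data.List.Membership.Propositional.Properties using (∈-allFin; ∈-lookup; ∈-map⁺)
open import Data.List.Properties using (length-map; length-removeAt′)
open import Data.List.Relation.Unary.All as All using (All; []; _∷_)
open import Data.List.Relation.Unary.All.Properties using (¬Any⇒All¬)
open import Data.List.Relation.Unary.AllPairs using ([]; _∷_)
open import Data.List.Relation.Unary.Any using (here; there; _─_; index)
open import Data.List.Relation.Unary.Linked using (Linked; []; [-]; _∷_)
open import Data.List.Relation.Unary.Linked.Properties using (++⁺)
open import Data.List.Relation.Unary.Unique.Propositional using (Unique)
open import Data.Maybe using (just)
open import Data.Maybe.Properties using (just-injective)
import Data.Maybe.Relation.Binary.Connected as Maybe
open import Data.Nat using (ℕ; zero; suc; _+_; _*_; _∸_; _≤_; _<_; z≤n; s≤s; s≤s⁻¹; _≤?_)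
open import Data.Nat.Induction using (<-rec)
open import Data.Nat.Properties
open import Algebra.Properties.CommutativeSemigroup +-commutativeSemigroup using (x∙yz≈y∙xz)
open import Data.Product using (∃-syntax; _×_; _,_; proj₁; proj₂)
open import Data.Sum using (_⊎_; inj₁; inj₂)
open import Data.Vec using (tabulate; []; _∷_; here; there)
open import Data.Vec.Properties using (lookup∘tabulate; []=⇒lookup; lookup⇒[]=)
open import Function using (Injective)
open import Relation.Binary.PropositionalEquality using (_≡_; refl; sym; trans; cong; subst; module ≡-Reasoning)
open import Relation.Nullary using (¬_; Dec; yes; no; does)
open import Relation.Nullary.Decidable
  using (_×-dec_; _⊎-dec_; _→-dec_; ¬?; map′; dec-true; decidable-stable)
open import Relation.Unary using (Decidable)

minimal-witness : {P : ℕ → Set} → Decidable P → ∀ {k} → P k → ∃[ m ] (P m × (∀ j → P j → m ≤ j))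
minimal-witness {P} P? = <-rec (λ k → P k → Least) search _
  where
  Least = ∃[ m ] (P m × (∀ j → P j → m ≤ j))
  search : ∀ k → (∀ {j} → j < k → P j → Least) → P k → Least
  search k below pk with anyUpTo? P? k
  ... | yes (j , j<k , pj) = below j<k pj
  ... | no ∄ = k , pk , λ j pj → ≮⇒≥ (λ j<k → ∄ (j , j<k , pj))

lookup-injective : {A : Set} {xs : List A} → Unique xs → Injective _≡_ _≡_ (lookup xs)
lookup-injective (_ ∷ _)       {zero}  {zero}  _  = refl
lookup-injective (x∉xs ∷ _)    {zero}  {suc j} eq = ⊥-elim (All.lookup x∉xs (∈-lookup j) eq)
lookup-injective (x∉xs ∷ _)    {suc i} {zero}  eq = ⊥-elim (All.lookup x∉xs (∈-lookup i) (sym eq))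
lookup-injective (_ ∷ unique)  {suc i} {suc j} eq = cong suc (lookup-injective unique eq)

Unique⇒length≤ : ∀ {n} {xs : List (Fin n)} → Unique xs → length xs ≤ n
Unique⇒length≤ unique = injective⇒≤ (lookup-injective unique)

elements : ∀ {n} → Subset n → List (Fin n)
elements [] = []
elements (inside ∷ p) = zero ∷ map suc (elements p)
elements (outside ∷ p) = map suc (elements p)

length-elements : ∀ {n} (p : Subset n) → length (elements p) ≡ ∣ p ∣
length-elements [] = refl
length-elements (inside ∷ p) = cong suc (trans (length-map suc (elements p)) (length-elements p))
length-elements (outside ∷ p) = trans (length-map suc (elements p)) (length-elements p)

∈-elements : ∀ {n} {x : Fin n} (p : Subset n) → x ∈ₛ p → x ∈ elements p
∈-elements (inside ∷ p) here = here refl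
∈-elements (inside ∷ p) (there x∈p) = there (∈-map⁺ suc (∈-elements p x∈p))
∈-elements (outside ∷ p) (there x∈p) = ∈-map⁺ suc (∈-elements p x∈p)

∈-─ : {A : Set} {x y : A} (xs : List A) (x∈xs : x ∈ xs) → y ∈ xs → y ≡ x ⊎ y ∈ (xs ─ x∈xs)
∈-─ (_ ∷ _) (here refl) (here refl) = inj₁ refl
∈-─ (_ ∷ _) (here refl) (there y∈) = inj₂ y∈
∈-─ (_ ∷ _) (there x∈) (here refl) = inj₂ (here refl)
∈-─ (_ ∷ xs) (there x∈) (there y∈) with ∈-─ xs x∈ y∈
... | inj₁ y≡x = inj₁ y≡x
... | inj₂ y∈′ = inj₂ (there y∈′)

-- Balls are (centre, radius) pairs weighted by radius + 1, so the p-balls around S weigh |S|(1 + p).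
weight : {A : Set} → List (A × ℕ) → ℕ
weight [] = 0
weight ((_ , q) ∷ balls) = suc q + weight balls

weight-─ : {A : Set} {x : A} {q : ℕ} (balls : List (A × ℕ)) (x∈ : (x , q) ∈ balls) →
           weight balls ≡ suc q + weight (balls ─ x∈)
weight-─ (_ ∷ _) (here refl) = refl
weight-─ {q = q} ((_ , q′) ∷ balls) (there x∈) =
  trans (cong (suc q′ +_) (weight-─ balls x∈)) (x∙yz≈y∙xz (suc q′) (suc q) _)

weight-map : {A : Set} (q : ℕ) (xs : List A) → weight (map (_, q) xs) ≡ length xs * suc q
weight-map q [] = refl
weight-map q (x ∷ xs) = cong (suc q +_) (weight-map q xs)

module _ {n : ℕ} (G : Graph n) where

  adj? : ∀ u v → Dec (Adj G u v)
  adj? u v with Graph.adj G u v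
  ... | true = yes refl
  ... | false = no λ ()

  Adj-sym : ∀ {u v} → Adj G u v → Adj G v u
  Adj-sym {u} {v} = trans (Graph.sym G v u)

  walk? : ∀ u v k → Dec (Walk G u v k)
  walk? u v zero with u ≟ᶠ v
  ... | yes refl = yes here
  ... | no u≢v = no λ { here → u≢v refl }
  walk? u v (suc k) with any? (λ w → adj? u w ×-dec walk? w v k)
  ... | yes (w , uw , p) = yes (step uw p)
  ... | no ∄ = no λ { (step uw p) → ∄ (_ , uw , p) }

  walk-snoc : ∀ {a b c k} → Walk G a b k → Adj G b c → Walk G a c (suc k)
  walk-snoc here bc = step bc here
  walk-snoc (step e p) bc = step e (walk-snoc p bc)

  walk-unsnoc : ∀ {a c k} → Walk G a c (suc k) → ∃[ b ] (Walk G a b k × Adj G b c)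
  walk-unsnoc (step e here) = _ , here , e
  walk-unsnoc (step e (step e′ p)) with walk-unsnoc (step e′ p)
  ... | b , q , bc = b , step e q , bc

  walk-++ : ∀ {a b c k l} → Walk G a b k → Walk G b c l → Walk G a c (k + l)
  walk-++ here q = q
  walk-++ (step e p) q = step e (walk-++ p q)

  walk-reverse : ∀ {a b k} → Walk G a b k → Walk G b a k
  walk-reverse here = here
  walk-reverse (step e p) = walk-snoc (walk-reverse p) (Adj-sym e)

  walk-splitAt : ∀ {a b} j {l} → Walk G a b (j + l) → ∃[ c ] (Walk G a c j × Walk G c b l)
  walk-splitAt zero p = _ , here , p
  walk-splitAt (suc j) (step e p) with walk-splitAt j p
  ... | c , q , r = c , step e q , r

  Within : Fin n → Fin n → ℕ → Set
  Within u v k = ∃[ m ] (m ≤ k × Walk G u v m)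

  within? : ∀ u v k → Dec (Within u v k)
  within? u v k = map′ (λ (m , m<1+k , p) → m , s≤s⁻¹ m<1+k , p) (λ (m , m≤k , p) → m , s≤s m≤k , p)
                       (anyUpTo? (walk? u v) (suc k))

  within-refl : ∀ {u} → Within u u 0
  within-refl = 0 , z≤n , here

  within-weaken : ∀ {u v k l} → k ≤ l → Within u v k → Within u v l
  within-weaken k≤l (m , m≤k , p) = m , ≤-trans m≤k k≤l , p

  within-trans : ∀ {u v w k l} → Within u v k → Within v w l → Within u w (k + l)
  within-trans (m , m≤k , p) (m′ , m′≤l , q) = m + m′ , +-mono-≤ m≤k m′≤l , walk-++ p q

  within-sym : ∀ {u v k} → Within u v k → Within v u k
  within-sym (m , m≤k , p) = m , m≤k , walk-reverse p

  within-step : ∀ {u v w k} → Within u v k → Adj G v w → Within u w (suc k)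
  within-step (m , m≤k , p) e = suc m , s≤s m≤k , walk-snoc p e

  within-split : ∀ {u v} j l → Within u v (j + l) → ∃[ c ] (Within u c j × Within c v l)
  within-split j l (m , m≤j+l , p) with m ≤? j
  ... | yes m≤j = _ , (m , m≤j , p) , within-weaken z≤n within-refl
  ... | no m≰j with walk-splitAt j (subst (Walk G _ _) (sym (m+[n∸m]≡n (≰⇒≥ m≰j))) p)
  ... | c , q , r = c , (j , ≤-refl , q) , (m ∸ j , m≤n+o⇒m∸n≤o m j m≤j+l , r)

  -- c lies on the walk r₀ ⋯ x y ⋯ r, within q of r₀ and within q₀ + 1 of r.
  merge-balls : ∀ {r₀ q₀ r q x y} → Within r₀ x q₀ → Adj G x y → Within r y q →
                ∃[ c ] ((∀ {v} → Within r₀ v q₀ → Within c v (suc q₀ + q)) ×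
                        (∀ {v} → Within r v q → Within c v (suc q₀ + q)))
  merge-balls {r₀} {q₀} {r} {q} r₀x xy ry
    with within-split q (suc q₀)
           (subst (Within r₀ r) (+-comm (suc q₀) q) (within-trans (within-step r₀x xy) (within-sym ry)))
  ... | c , r₀c , cr =
    c , (λ r₀v → within-weaken (≤-trans (≤-reflexive (+-comm q q₀)) (n≤1+n _)) (within-trans (within-sym r₀c) r₀v)) ,
        (λ rv → within-trans cr rv)

  exit-edge : ∀ {P : Fin n → Set} → Decidable P → ∀ {a b k} → Walk G a b k → P a → ¬ P b →
              ∃[ x ] ∃[ y ] (P x × Adj G x y × ¬ P y)
  exit-edge P? here pa ¬pb = ⊥-elim (¬pb pa)
  exit-edge P? (step {w = w} e p) pa ¬pb with P? w
  ... | yes pw = exit-edge P? p pw ¬pb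
  ... | no ¬pw = _ , w , pa , e , ¬pw

  IsDist-unique : ∀ {u v d d′} → IsDist G u v d → IsDist G u v d′ → d ≡ d′
  IsDist-unique (p , least) (p′ , least′) = ≤-antisym (least _ p′) (least′ _ p)

  IsDist⇒≤ : ∀ {u v d k} → IsDist G u v d → Within u v k → d ≤ k
  IsDist⇒≤ (_ , least) (m , m≤k , p) = ≤-trans (least m p) m≤k

  IsEcc-unique : ∀ {v e e′} → IsEcc G v e → IsEcc G v e′ → e ≡ e′
  IsEcc-unique (bound , u , du) (bound′ , u′ , du′) = ≤-antisym (bound′ u _ du) (bound u′ _ du′)

  IsEcc⇒≤ : ∀ {v e k} → IsEcc G v e → (∀ u → Within v u k) → e ≤ k
  IsEcc⇒≤ (_ , u , du) within = IsDist⇒≤ du (within u)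

  module _ (connected : Connected G) where

    distance : ∀ u v → ∃[ d ] IsDist G u v d
    distance u v = minimal-witness (walk? u v) (proj₂ (connected u v))

    dist : Fin n → Fin n → ℕ
    dist u v = proj₁ (distance u v)

    eccentricity : ∀ v → ∃[ e ] IsEcc G v e
    eccentricity v = dist v far , farthest , far , proj₂ (distance v far)
      where
      far = argmax (dist v) v (allFin n)
      farthest : ∀ u d → IsDist G v u d → d ≤ dist v far
      farthest u d isDist = subst (_≤ dist v far) (IsDist-unique (proj₂ (distance v u)) isDist)
        (All.lookup (f[xs]≤f[argmax] {f = dist v} v (allFin n)) (∈-allFin u))

    ecc : Fin n → ℕ
    ecc v = proj₁ (eccentricity v)

    radius : Fin n → ∃[ r ] IsRadius G r
    radius v₀ = ecc c , (c , proj₂ (eccentricity c)) , central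
      where
      c = argmin ecc v₀ (allFin n)
      central : ∀ v e → IsEcc G v e → ecc c ≤ e
      central v e isEcc = subst (ecc c ≤_) (IsEcc-unique (proj₂ (eccentricity v)) isEcc)
        (All.lookup (f[argmin]≤f[xs] {f = ecc} v₀ (allFin n)) (∈-allFin v))

  open import Data.List.Membership.DecPropositional (_≟ᶠ_ {n}) using () renaming (_∈?_ to _∈ᴸ?_)

  record WhitePath (B : Fin n → Set) (w y : Fin n) : Set where
    constructor whitePath
    field
      rest   : List (Fin n)
      unique : Unique (y ∷ rest)
      linked : Linked (Adj G) (y ∷ rest)
      white  : All (λ x → ¬ B x) (y ∷ rest)
      ends   : last (y ∷ rest) ≡ just w

  whitePath-suffix : ∀ {B w z} y rest → z ∈ y ∷ rest → Unique (y ∷ rest) → Linked (Adj G) (y ∷ rest) →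
                     All (λ x → ¬ B x) (y ∷ rest) → last (y ∷ rest) ≡ just w → WhitePath B w z
  whitePath-suffix y rest (here refl) u l a e = whitePath rest u l a e
  whitePath-suffix y (y′ ∷ rest) (there z∈) (_ ∷ u) (_ ∷ l) (_ ∷ a) e = whitePath-suffix y′ rest z∈ u l a e

  ReachW⇒WhitePath : ∀ {B w y} → ReachW G B w y → WhitePath B w y
  ReachW⇒WhitePath (rrefl ¬b) = whitePath [] ([] ∷ []) [-] (¬b ∷ []) refl
  ReachW⇒WhitePath (rstep {y = y} {z = z} r yz ¬bz) with ReachW⇒WhitePath r
  ... | whitePath rest u l a e with z ∈ᴸ? (y ∷ rest)
  ... | yes z∈ = whitePath-suffix y rest z∈ u l a e
  ... | no z∉ = whitePath (y ∷ rest) (¬Any⇒All¬ _ z∉ ∷ u) (Adj-sym yz ∷ l) (¬bz ∷ a) e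

  ReachWithin : (Fin n → Set) → Fin n → Fin n → ℕ → Set
  ReachWithin B x y zero = x ≡ y × ¬ B x
  ReachWithin B x y (suc k) = ReachWithin B x y k ⊎ ∃[ z ] (ReachWithin B x z k × Adj G z y × ¬ B y)

  reachWithin? : ∀ {B} → Decidable B → ∀ x y k → Dec (ReachWithin B x y k)
  reachWithin? B? x y zero = (x ≟ᶠ y) ×-dec ¬? (B? x)
  reachWithin? B? x y (suc k) =
    reachWithin? B? x y k ⊎-dec any? (λ z → reachWithin? B? x z k ×-dec adj? z y ×-dec ¬? (B? y))

  ReachWithin⇒ReachW : ∀ {B x y} k → ReachWithin B x y k → ReachW G B x y
  ReachWithin⇒ReachW zero (refl , ¬b) = rrefl ¬b
  ReachWithin⇒ReachW (suc k) (inj₁ r) = ReachWithin⇒ReachW k r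
  ReachWithin⇒ReachW (suc k) (inj₂ (z , r , zy , ¬b)) = rstep (ReachWithin⇒ReachW k r) zy ¬b

  reachWithin-weaken : ∀ {B x y k l} → k ≤ l → ReachWithin B x y k → ReachWithin B x y l
  reachWithin-weaken {l = zero} z≤n r = r
  reachWithin-weaken {l = suc l} k≤1+l r with m≤n⇒m<n∨m≡n k≤1+l
  ... | inj₁ k<1+l = inj₁ (reachWithin-weaken (s≤s⁻¹ k<1+l) r)
  ... | inj₂ refl = r

  WhitePath⇒ReachWithin : ∀ {B w} y rest → Linked (Adj G) (y ∷ rest) → All (λ x → ¬ B x) (y ∷ rest) →
                          last (y ∷ rest) ≡ just w → ReachWithin B w y (length rest)
  WhitePath⇒ReachWithin y [] _ (¬b ∷ []) refl = refl , ¬b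
  WhitePath⇒ReachWithin y (y′ ∷ rest) (yy′ ∷ l) (¬b ∷ a) e =
    inj₂ (y′ , WhitePath⇒ReachWithin y′ rest l a e , Adj-sym yy′ , ¬b)

  ReachW⇒ReachWithin : ∀ {B x y} → ReachW G B x y → ReachWithin B x y n
  ReachW⇒ReachWithin {y = y} r with ReachW⇒WhitePath r
  ... | whitePath rest u l a e =
    reachWithin-weaken (≤-trans (n≤1+n _) (Unique⇒length≤ u)) (WhitePath⇒ReachWithin y rest l a e)

  reachW? : ∀ {B} → Decidable B → ∀ x y → Dec (ReachW G B x y)
  reachW? B? x y = map′ (ReachWithin⇒ReachW n) ReachW⇒ReachWithin (reachWithin? B? x y n)

  canForce? : ∀ {B} → Decidable B → ∀ u w → Dec (CanForce G B u w)
  canForce? B? u w = B? u ×-dec ¬? (B? w) ×-dec adj? u w ×-dec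
    all? (λ x → adj? u x →-dec ¬? (B? x) →-dec reachW? B? w x →-dec (x ≟ᶠ w))

  blue? : ∀ S i → Decidable (Blue G S i)
  blue? S zero v = v ∈? S
  blue? S (suc i) v = blue? S i v ⊎-dec any? (λ u → canForce? (blue? S i) u v)

  allBlue? : ∀ S i → Dec (AllBlue G S i)
  allBlue? S i = all? (blue? S i)

  ReachW-antitone : ∀ {B B′ : Fin n → Set} {x y} → (∀ v → B′ v → B v) → ReachW G B x y → ReachW G B′ x y
  ReachW-antitone B′⊆B (rrefl ¬b) = rrefl (λ b′ → ¬b (B′⊆B _ b′))
  ReachW-antitone B′⊆B (rstep r e ¬b) = rstep (ReachW-antitone B′⊆B r) e (λ b′ → ¬b (B′⊆B _ b′))

  CanForce-resp : ∀ {B B′ : Fin n → Set} {u w} → (∀ v → B v → B′ v) → (∀ v → B′ v → B v) →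
                  CanForce G B u w → CanForce G B′ u w
  CanForce-resp B⊆B′ B′⊆B (bu , ¬bw , uw , only) =
    B⊆B′ _ bu , (λ b′ → ¬bw (B′⊆B _ b′)) , uw ,
    λ x ux ¬b′x r → only x ux (λ bx → ¬b′x (B⊆B′ _ bx)) (ReachW-antitone B⊆B′ r)

  Blue-mono : ∀ {S i j v} → i ≤ j → Blue G S i v → Blue G S j v
  Blue-mono {j = zero} z≤n b = b
  Blue-mono {j = suc j} i≤1+j b with m≤n⇒m<n∨m≡n i≤1+j
  ... | inj₁ i<1+j = inj₁ (Blue-mono (s≤s⁻¹ i<1+j) b)
  ... | inj₂ refl = b

  Blue-stalled : ∀ {S k} → (∀ v → Blue G S (suc k) v → Blue G S k v) → ∀ m v → Blue G S m v → Blue G S k v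
  Blue-stalled {S} {k} stall m v b with m ≤? k
  ... | yes m≤k = Blue-mono m≤k b
  ... | no m≰k = beyond (m ∸ k) v (subst (λ q → Blue G S q v) (sym (m∸n+n≡m (≰⇒≥ m≰k))) b)
    where
    -- Inductively the blue sets at times j + k and k agree, so a force at time j + k is one at time k.
    beyond : ∀ j v → Blue G S (j + k) v → Blue G S k v
    beyond zero v b = b
    beyond (suc j) v (inj₁ b) = beyond j v b
    beyond (suc j) v (inj₂ (u , force)) =
      stall v (inj₂ (u , CanForce-resp (beyond j) (λ x → Blue-mono (m≤n+m k j)) force))

  blueSet : Subset n → ℕ → Subset n
  blueSet S i = tabulate (λ v → does (blue? S i v))

  ∈-blueSet⁺ : ∀ {S i v} → Blue G S i v → v ∈ₛ blueSet S i
  ∈-blueSet⁺ {S} {i} {v} b = lookup⇒[]= v _ (trans (lookup∘tabulate _ v) (dec-true (blue? S i v) b))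

  ∈-blueSet⁻ : ∀ {S i v} → v ∈ₛ blueSet S i → Blue G S i v
  ∈-blueSet⁻ {S} {i} {v} v∈ with blue? S i v | trans (sym (lookup∘tabulate _ v)) ([]=⇒lookup v∈)
  ... | yes b | _ = b

  blueSet-grows : ∀ {S k v} → Blue G S (suc k) v → ¬ Blue G S k v → ∣ blueSet S k ∣ < ∣ blueSet S (suc k) ∣
  blueSet-grows {v = v} new ¬old =
    p⊂q⇒∣p∣<∣q∣ ((λ v∈ → ∈-blueSet⁺ (inj₁ (∈-blueSet⁻ v∈))) , v , ∈-blueSet⁺ new , λ v∈ → ¬old (∈-blueSet⁻ v∈))

  Blue-grows-or-stalls : ∀ S k → k ≤ ∣ blueSet S k ∣ ⊎ (∀ m v → Blue G S m v → Blue G S k v)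
  Blue-grows-or-stalls S zero = inj₁ z≤n
  Blue-grows-or-stalls S (suc k) with Blue-grows-or-stalls S k
  ... | inj₂ stable = inj₂ (λ m v b → inj₁ (stable m v b))
  ... | inj₁ k≤∣Sₖ∣ with any? (λ v → blue? S (suc k) v ×-dec ¬? (blue? S k v))
  ... | yes (v , new , ¬old) = inj₁ (≤-trans (s≤s k≤∣Sₖ∣) (blueSet-grows new ¬old))
  ... | no ∄ = inj₂ (λ m v b → inj₁ (Blue-stalled stall m v b))
    where
    stall : ∀ v → Blue G S (suc k) v → Blue G S k v
    stall v b = decidable-stable (blue? S k v) (λ ¬b → ∄ (v , b , ¬b))

  Blue-saturated : ∀ S m v → Blue G S m v → Blue G S n v
  Blue-saturated S m v b with Blue-grows-or-stalls S n
  ... | inj₂ stable = stable m v b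
  ... | inj₁ n≤∣Sₙ∣ = ∈-blueSet⁻ (subst (v ∈ₛ_) (sym (∣p∣≡n⇒p≡⊤ (≤-antisym (∣p∣≤n (blueSet S n)) n≤∣Sₙ∣))) ∈⊤)

  forcing? : ∀ S → Dec (IsPSDForcingSet G S)
  forcing? S = map′ (n ,_) (λ (m , all) v → Blue-saturated S m v (all v)) (allBlue? S n)

  propTime : ∀ {S} → IsPSDForcingSet G S → ∃[ p ] IsPSDPropTime G S p
  propTime {S} (_ , all) = minimal-witness (allBlue? S) all

  IsPSDPropTime-unique : ∀ {S p p′} → IsPSDPropTime G S p → IsPSDPropTime G S p′ → p ≡ p′
  IsPSDPropTime-unique (all , least) (all′ , least′) = ≤-antisym (least _ all′) (least′ _ all)

  ⊤-forcing : IsPSDForcingSet G ⊤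
  ⊤-forcing = 0 , λ v → ∈⊤

  Zplus : ∃[ z ] IsZplus G z
  Zplus with minimal-witness (λ z → anySubset? (λ S → forcing? S ×-dec (∣ S ∣ ≟ z))) (⊤ , ⊤-forcing , ∣⊤∣≡n n)
  ... | z , witness , least = z , witness , λ S forcing → least _ (S , forcing , refl)

  IsZplus-unique : ∀ {z z′} → IsZplus G z → IsZplus G z′ → z ≡ z′
  IsZplus-unique ((S , forcing , refl) , least) ((S′ , forcing′ , refl) , least′) =
    ≤-antisym (least S′ forcing′) (least′ S forcing)

  Throttles : ℕ → Subset n → ℕ → Set
  Throttles z S t = ∃[ p ] (IsPSDPropTime G S p × z ≤ ∣ S ∣ × ∣ S ∣ * (1 + p) ≡ t)

  throttles? : ∀ z S t → Dec (Throttles z S t)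
  throttles? z S t with forcing? S
  ... | no ¬forcing = no λ (p , (all , _) , _) → ¬forcing (p , all)
  ... | yes forcing with propTime forcing
  ... | p , pt = map′ (λ (z≤ , eq) → p , pt , z≤ , eq)
                      (λ (p′ , pt′ , z≤ , eq) → z≤ , subst (λ q → ∣ S ∣ * (1 + q) ≡ t) (IsPSDPropTime-unique pt′ pt) eq)
                      ((z ≤? ∣ S ∣) ×-dec (∣ S ∣ * (1 + p) ≟ t))

  throttling : ∃[ t ] IsPSDProdThrottling G t
  throttling with Zplus
  ... | z , isZ with propTime ⊤-forcing
  ... | p⊤ , pt⊤
    with minimal-witness (λ t → anySubset? (λ S → throttles? z S t)) (⊤ , p⊤ , pt⊤ , proj₂ isZ ⊤ ⊤-forcing , refl)
  ... | t , (S , p , pt , z≤ , eq) , least =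
    t , (S , p , z , isZ , z≤ , pt , eq) ,
    λ S′ p′ z′ isZ′ z′≤ pt′ → least _ (S′ , p′ , pt′ , subst (_≤ ∣ S′ ∣) (IsZplus-unique isZ′ isZ) z′≤ , refl)

  Blue⇒within : ∀ {S i v} → Blue G S i v → ∃[ s ] (s ∈ₛ S × Within s v i)
  Blue⇒within {i = zero} v∈S = _ , v∈S , within-refl
  Blue⇒within {i = suc i} (inj₁ b) with Blue⇒within b
  ... | s , s∈S , sv = s , s∈S , within-weaken (n≤1+n i) sv
  Blue⇒within {i = suc i} (inj₂ (u , bu , _ , uv , _)) with Blue⇒within bu
  ... | s , s∈S , su = s , s∈S , within-step su uv

  Covers : List (Fin n × ℕ) → Set
  Covers balls = ∀ v → ∃[ r ] ∃[ q ] ((r , q) ∈ balls × Within r v q)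

  module _ (connected : Connected G) where

    cover-shrink : ∀ r₀ q₀ rest → Covers ((r₀ , q₀) ∷ rest) → ¬ (∀ v → Within r₀ v q₀) →
                   ∃[ balls ] (length balls ≡ length rest × weight balls ≡ weight ((r₀ , q₀) ∷ rest) × Covers balls)
    cover-shrink r₀ q₀ rest covers ¬inBall
      with v , ¬r₀v ← ¬∀⟶∃¬ n _ (λ v → within? r₀ v q₀) ¬inBall
      with x , y , r₀x , xy , ¬r₀y ← exit-edge (λ v → within? r₀ v q₀) (proj₂ (connected r₀ v))
                                               (within-weaken z≤n within-refl) ¬r₀v
      with covers y
    ... | _ , _ , here refl , r₀y = ⊥-elim (¬r₀y r₀y)
    ... | r , q , there rq∈ , ry with merge-balls r₀x xy ry
    ... | c , from-r₀ , from-r =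
      (c , suc q₀ + q) ∷ (rest ─ rq∈) , sym (length-removeAt′ rest (index rq∈)) , weight-merged , covers-merged
      where
      open ≡-Reasoning
      weight-merged : weight ((c , suc q₀ + q) ∷ (rest ─ rq∈)) ≡ weight ((r₀ , q₀) ∷ rest)
      weight-merged = begin
        suc (suc q₀ + q) + weight (rest ─ rq∈)   ≡⟨ cong suc (+-assoc (suc q₀) q _) ⟩
        suc (suc q₀ + (q + weight (rest ─ rq∈))) ≡⟨ sym (+-suc (suc q₀) _) ⟩
        suc q₀ + (suc q + weight (rest ─ rq∈))   ≡⟨ cong (suc q₀ +_) (weight-─ rest rq∈) ⟨
        suc q₀ + weight rest                     ∎

      covers-merged : Covers ((c , suc q₀ + q) ∷ (rest ─ rq∈))
      covers-merged v with covers v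
      ... | _ , _ , here refl , r₀v = c , _ , here refl , from-r₀ r₀v
      ... | r′ , q′ , there r′q′∈ , r′v with ∈-─ rest rq∈ r′q′∈
      ... | inj₁ refl = c , _ , here refl , from-r r′v
      ... | inj₂ r′q′∈′ = r′ , q′ , there r′q′∈′ , r′v

    cover-merge : ∀ k balls → length balls ≡ k → Covers balls → Fin n →
                  ∃[ c ] ∃[ q ] (suc q ≤ weight balls × (∀ v → Within c v q))
    cover-merge k [] _ covers v₀ with covers v₀
    ... | _ , _ , () , _
    cover-merge (suc k) ((r₀ , q₀) ∷ rest) length≡ covers v₀ with all? (λ v → within? r₀ v q₀)
    ... | yes inBall = r₀ , q₀ , m≤m+n (suc q₀) (weight rest) , inBall
    ... | no ¬inBall with cover-shrink r₀ q₀ rest covers ¬inBall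
    ... | balls , length≡′ , weight≡ , covers′
      with cover-merge k balls (trans length≡′ (suc-injective length≡)) covers′ v₀
    ... | c , q , bound , inBall = c , q , ≤-trans bound (≤-reflexive weight≡) , inBall

    radius-bound : ∀ {balls r} → Covers balls → Fin n → IsRadius G r → suc r ≤ weight balls
    radius-bound {balls} covers v₀ (_ , central) with cover-merge _ balls refl covers v₀
    ... | c , q , bound , inBall = ≤-trans (s≤s (≤-trans (central c _ isEcc) (IsEcc⇒≤ isEcc inBall))) bound
      where isEcc = proj₂ (eccentricity connected c)

    radius-bound-blue : ∀ {S p r} → AllBlue G S p → Fin n → IsRadius G r → suc r ≤ ∣ S ∣ * suc p
    radius-bound-blue {S} {p} allBlue v₀ isRadius =
      subst (_ ≤_) (trans (weight-map p (elements S)) (cong (_* suc p) (length-elements S)))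
        (radius-bound covers v₀ isRadius)
      where
      covers : Covers (map (_, p) (elements S))
      covers v with Blue⇒within (allBlue v)
      ... | s , s∈S , sv = s , p , ∈-map⁺ (_, p) (∈-elements S s∈S) , sv

    throttling-lower-bound : ∀ {r t} → Fin n → IsRadius G r → IsPSDProdThrottling G t → suc r ≤ t
    throttling-lower-bound v₀ isRadius ((S , p , _ , _ , _ , (allBlue , _) , refl) , _) =
      radius-bound-blue allBlue v₀ isRadius

  tree-force : IsTree G → ∀ {B u w x} → B u → Adj G u w → Adj G u x → ReachW G B w x → x ≡ w
  tree-force tree {B} {u} {w} {x} bu uw ux r with ReachW⇒WhitePath r
  ... | whitePath [] _ _ _ e = just-injective e
  ... | whitePath (y ∷ rest) unique linked white e =
    ⊥-elim (proj₂ tree (u ∷ x ∷ y ∷ rest)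
      (s≤s (s≤s (s≤s z≤n)) ,
       All.map (λ ¬b u≡ → ¬b (subst B u≡ bu)) white ∷ unique ,
       ux ∷ ++⁺ linked (subst (λ m → Maybe.Connected (Adj G) m (just u)) (sym e) (Maybe.just (Adj-sym uw))) [-]))

  tree-Blue-ball : IsTree G → ∀ {S s} → s ∈ₛ S → ∀ i {v} → Within s v i → Blue G S i v
  tree-Blue-ball tree s∈S zero (.0 , z≤n , here) = s∈S
  tree-Blue-ball tree {S} s∈S (suc i) {v} (m , m≤1+i , p) with m≤n⇒m<n∨m≡n m≤1+i
  ... | inj₁ m<1+i = inj₁ (tree-Blue-ball tree s∈S i (m , s≤s⁻¹ m<1+i , p))
  ... | inj₂ refl with blue? S i v | walk-unsnoc p
  ... | yes b | _ = inj₁ b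
  ... | no ¬b | u , su , uv = inj₂ (u , bu , ¬b , uv , λ x ux _ r → tree-force tree bu uv ux r)
    where bu = tree-Blue-ball tree s∈S i (i , ≤-refl , su)

  tree-center-forces : IsTree G → ∀ {c r} → IsEcc G c r → AllBlue G ⁅ c ⁆ r
  tree-center-forces tree {c} {r} (eccBound , _) v with distance (proj₁ tree) c v
  ... | d , isDist@(p , _) = tree-Blue-ball tree (x∈⁅x⁆ c) r (d , eccBound v d isDist , p)

  tree-throttling-upper-bound : ∀ {r t} → IsTree G → IsRadius G r → IsPSDProdThrottling G t → t ≤ suc r
  tree-throttling-upper-bound {r} {t} tree ((c , isEcc) , _) ((_ , _ , z , isZ , _) , optimal)
    with allBlue ← tree-center-forces tree isEcc | propTime (r , allBlue)
  ... | p , isPropTime@(_ , least) = begin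
    t                 ≤⟨ optimal ⁅ c ⁆ p z isZ (proj₂ isZ ⁅ c ⁆ (r , allBlue)) isPropTime ⟩
    ∣ ⁅ c ⁆ ∣ * suc p ≡⟨ cong (_* suc p) (∣⁅x⁆∣≡1 c) ⟩
    1 * suc p         ≡⟨ *-identityˡ (suc p) ⟩
    suc p             ≤⟨ s≤s (least r allBlue) ⟩
    suc r             ∎
    where open ≤-Reasoning

mainTheorem2 : ∀ (n : ℕ) (G : Graph n) → 0 < n → Connected G →
    ∃[ t ] ∃[ r ] (IsPSDProdThrottling G t × IsRadius G r ×
      (1 + r ≤ t) × (IsTree G → t ≡ 1 + r))
mainTheorem2 n G 0<n connected =
  let v₀ = fromℕ< 0<n
      (t , isThrottling) = throttling G
      (r , isRadius) = radius G connected v₀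
      lower = throttling-lower-bound G connected v₀ isRadius isThrottling
  in t , r , isThrottling , isRadius , lower ,
     λ tree → ≤-antisym (tree-throttling-upper-bound G tree isRadius isThrottling) lower
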